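{- Let $d\geq 2$, $c\in\mathbb{N}$ and $w\in\{1,\ldots,d\}^{\mathbb{N}}$. If $w$ is $c$-balanced, then for every pair of distinct letters $i,j\in\{1,\ldots,d\}$, the projection $\pi_{i,j}(w)$ is $c$-balanced.
   Context: A (finite or infinite) word is $c$-balanced if for any two equally long factors (contiguous subwords) $u,v$ and any letter $a$, $||u|_a-|v|_a|\leq c$, where $|u|_a$ is the number of occurrences of $a$ in $u$. The projection $\pi_{i,j}(w)$ is obtained from $w$ by erasing all letters other than $i$ and $j$. -}

module Defs where

open import Data.Nat using (ℕ; _+_; _≤_; ∣_-_∣)
open import Data.Fin using (Fin; _≟_)
open import Data.List using (List; map; upTo; filter; length; _++_)
open import Data.Product using (∃₂; _×_)
open import Data.Sum using (_⊎_)
open import Relation.Binary.PropositionalEquality using (_≡_)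
open import Relation.Nullary.Decidable using (_⊎-dec_)

count : {d : ℕ} → Fin d → List (Fin d) → ℕ
count a u = length (filter (λ x → x ≟ a) u)

Factor : {A : Set} → List A → List A → Set
Factor u v = ∃₂ λ p s → p ++ (u ++ s) ≡ v

BalancedList : {d : ℕ} → ℕ → List (Fin d) → Set
BalancedList c w = ∀ u v → Factor u w → Factor v w → length u ≡ length v →
  ∀ a → ∣ count a u - count a v ∣ ≤ c

factorAt : {d : ℕ} → (ℕ → Fin d) → ℕ → ℕ → List (Fin d)
factorAt w m n = map (λ k → w (m + k)) (upTo n)

-- c-balanced infinite word (all factors of w are the factorAt w m n)
Balanced : {d : ℕ} → ℕ → (ℕ → Fin d) → Set
Balanced c w = ∀ m m' n a → ∣ count a (factorAt w m n) - count a (factorAt w m' n) ∣ ≤ c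

prefix : {d : ℕ} → (ℕ → Fin d) → ℕ → List (Fin d)
prefix w n = factorAt w 0 n

project : {d : ℕ} → Fin d → Fin d → List (Fin d) → List (Fin d)
project i j = filter (λ x → (x ≟ i) ⊎-dec (x ≟ j))

-- π_{i,j}(w) (finite or infinite) is c-balanced: every factor of π_{i,j}(w)
-- is a factor of π_{i,j}(prefix of w), so this says all such finite
-- projections are c-balanced
ProjBalanced : {d : ℕ} → ℕ → Fin d → Fin d → (ℕ → Fin d) → Set
ProjBalanced c i j w = ∀ n → BalancedList c (project i j (prefix w n))

-- Let U, V be factors of w with |π_{i,j}(U)| = |π_{i,j}(V)|, i.e.
-- |U|_i + |U|_j = |V|_i + |V|_j.  If |U| ≤ |V|, comparing U with the prefix
-- of V of length |U| gives |U|_i ≤ |V|_i + c.  If |V| ≤ |U|, the same argument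
-- for the letter j gives |V|_j ≤ |U|_j + c, and the equation turns this into
-- |U|_i ≤ |V|_i + c again.  Since every factor of a projected prefix of w is
-- the projection of a factor of w, this bounds all letter counts.
module Submission where

open import Defs
open import Data.Nat using (ℕ; zero; suc; _+_; _≤_; z≤n; s≤s; ∣_-_∣)
open import Data.Nat.Properties
  using (≤-trans; ≤-total; +-comm; +-assoc; +-suc; +-identityʳ; +-monoʳ-≤; +-monoˡ-≤;
         +-cancelʳ-≤; m≤n+∣m-n∣; module ≤-Reasoning)
open import Data.Fin using (Fin; _≟_)
open import Data.List using (List; []; _∷_; _++_; length; map; filter; upTo; applyUpTo)
open import Data.List.Properties
  using (∷-injectiveˡ; ∷-injectiveʳ; map-∘; map-cong; map-upTo; filter-accept; filter-reject)
open import Data.Product using (∃; ∃₂; _×_; _,_)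
open import Data.Sum using (_⊎_; inj₁; inj₂)
open import Level using (0ℓ)
open import Relation.Nullary using (¬_; yes; no; contradiction)
open import Relation.Nullary.Decidable using (_⊎-dec_)
open import Relation.Unary using (Pred; Decidable)
open import Relation.Binary.PropositionalEquality
  using (_≡_; _≢_; refl; sym; trans; cong; cong₂; subst₂; module ≡-Reasoning)

∣m-n∣≤o⇒m≤n+o : ∀ {m n o} → ∣ m - n ∣ ≤ o → m ≤ n + o
∣m-n∣≤o⇒m≤n+o {m} {n} h = ≤-trans (m≤n+∣m-n∣ m n) (+-monoʳ-≤ n h)

m≤n+o∧n≤m+o⇒∣m-n∣≤o : ∀ m n o → m ≤ n + o → n ≤ m + o → ∣ m - n ∣ ≤ o
m≤n+o∧n≤m+o⇒∣m-n∣≤o zero    n       o _         n≤o       = n≤o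
m≤n+o∧n≤m+o⇒∣m-n∣≤o (suc m) zero    o m≤o       _         = m≤o
m≤n+o∧n≤m+o⇒∣m-n∣≤o (suc m) (suc n) o (s≤s m≤n) (s≤s n≤m) = m≤n+o∧n≤m+o⇒∣m-n∣≤o m n o m≤n n≤m

module _ {A : Set} {P : Pred A 0ℓ} (P? : Decidable P) where

  filter-≡-++ : ∀ xs ys zs → filter P? xs ≡ ys ++ zs →
    ∃₂ λ xs₁ xs₂ → xs₁ ++ xs₂ ≡ xs × filter P? xs₁ ≡ ys × filter P? xs₂ ≡ zs
  filter-≡-++ xs       []       zs e = [] , xs , refl , refl , e
  filter-≡-++ []       (y ∷ ys) zs ()
  filter-≡-++ (x ∷ xs) (y ∷ ys) zs e with P? x
  ... | yes Px =
    let xs₁ , xs₂ , e₁ , e₂ , e₃ = filter-≡-++ xs ys zs (∷-injectiveʳ e)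
    in x ∷ xs₁ , xs₂ , cong (x ∷_) e₁ , trans (filter-accept P? Px) (cong₂ _∷_ (∷-injectiveˡ e) e₂) , e₃
  ... | no ¬Px =
    let xs₁ , xs₂ , e₁ , e₂ , e₃ = filter-≡-++ xs (y ∷ ys) zs e
    in x ∷ xs₁ , xs₂ , cong (x ∷_) e₁ , trans (filter-reject P? ¬Px) e₂ , e₃

  factor-filter : ∀ {u xs} → Factor u (filter P? xs) → ∃ λ v → Factor v xs × filter P? v ≡ u
  factor-filter {u} {xs} (p , s , e) =
    let ys₁ , ys₂ , e₁ , _ , e₂ = filter-≡-++ xs p (u ++ s) (sym e)
        zs₁ , zs₂ , e₃ , e₄ , _ = filter-≡-++ ys₂ u s e₂
    in zs₁ , (ys₁ , zs₂ , trans (cong (ys₁ ++_) e₃) e₁) , e₄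

module _ {d : ℕ} where

  module _ {P : Pred (Fin d) 0ℓ} (P? : Decidable P) {a : Fin d} where

    count-filter-accept : P a → ∀ xs → count a (filter P? xs) ≡ count a xs
    count-filter-accept Pa []       = refl
    count-filter-accept Pa (x ∷ xs) with P? x
    ... | yes _ with x ≟ a
    ...   | yes _ = cong suc (count-filter-accept Pa xs)
    ...   | no _  = count-filter-accept Pa xs
    count-filter-accept Pa (x ∷ xs) | no ¬Px with x ≟ a
    ...   | yes refl = contradiction Pa ¬Px
    ...   | no _     = count-filter-accept Pa xs

    count-filter-reject : ¬ P a → ∀ xs → count a (filter P? xs) ≡ 0
    count-filter-reject ¬Pa []       = refl
    count-filter-reject ¬Pa (x ∷ xs) with P? x
    ... | no _ = count-filter-reject ¬Pa xs
    ... | yes Px with x ≟ a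
    ...   | yes refl = contradiction Px ¬Pa
    ...   | no _     = count-filter-reject ¬Pa xs

  count-∷-mono : ∀ {a} x {xs ys : List (Fin d)} → count a xs ≤ count a ys →
    count a (x ∷ xs) ≤ count a (x ∷ ys)
  count-∷-mono {a} x xs≤ys with x ≟ a
  ... | yes _ = s≤s xs≤ys
  ... | no _  = xs≤ys

  inPair? : (i j : Fin d) → Decidable (λ x → x ≡ i ⊎ x ≡ j)
  inPair? i j x = (x ≟ i) ⊎-dec (x ≟ j)

  length-project : ∀ {i j : Fin d} → i ≢ j → ∀ xs →
    length (project i j xs) ≡ count i xs + count j xs
  length-project i≢j [] = refl
  length-project {i} {j} i≢j (x ∷ xs) with x ≟ i | x ≟ j
  ... | yes refl | yes refl = contradiction refl i≢j
  ... | yes _    | no _     = cong suc (length-project i≢j xs)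
  ... | no _     | yes _    =
    trans (cong suc (length-project i≢j xs)) (sym (+-suc (count i xs) (count j xs)))
  ... | no _     | no _     = length-project i≢j xs

module _ {d : ℕ} (w : ℕ → Fin d) where

  factorAt-suc : ∀ m n → factorAt w m (suc n) ≡ w m ∷ factorAt w (suc m) n
  factorAt-suc m n = cong₂ _∷_ (cong w (+-identityʳ m)) (begin
    map (λ k → w (m + k)) (applyUpTo suc n)   ≡⟨ cong (map _) (map-upTo suc n) ⟨
    map (λ k → w (m + k)) (map suc (upTo n))  ≡⟨ map-∘ (upTo n) ⟨
    map (λ k → w (m + suc k)) (upTo n)        ≡⟨ map-cong (λ k → cong w (+-suc m k)) (upTo n) ⟩
    factorAt w (suc m) n                      ∎)
    where open ≡-Reasoning

  prefix-factorAt : ∀ m n u s → u ++ s ≡ factorAt w m n → u ≡ factorAt w m (length u)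
  prefix-factorAt m n       []      s e = refl
  prefix-factorAt m zero    (_ ∷ _) _ ()
  prefix-factorAt m (suc n) (x ∷ u) s e =
    let e′ = trans e (factorAt-suc m n)
    in trans (cong₂ _∷_ (∷-injectiveˡ e′) (prefix-factorAt (suc m) n u s (∷-injectiveʳ e′)))
             (sym (factorAt-suc m (length u)))

  factor-factorAt : ∀ m n {u} → Factor u (factorAt w m n) → ∃₂ λ m′ k → u ≡ factorAt w m′ k
  factor-factorAt m n       {u} ([]    , s , e) = m , length u , prefix-factorAt m n u s e
  factor-factorAt m zero        (_ ∷ _ , _ , ())
  factor-factorAt m (suc n)     (_ ∷ p , s , e) =
    factor-factorAt (suc m) n (p , s , ∷-injectiveʳ (trans e (factorAt-suc m n)))

  count-factorAt-mono : ∀ a m {k k′} → k ≤ k′ → count a (factorAt w m k) ≤ count a (factorAt w m k′)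
  count-factorAt-mono a m z≤n = z≤n
  count-factorAt-mono a m (s≤s {k} {k′} k≤k′) =
    subst₂ (λ xs ys → count a xs ≤ count a ys) (sym (factorAt-suc m k)) (sym (factorAt-suc m k′))
      (count-∷-mono (w m) (count-factorAt-mono a (suc m) k≤k′))

module _ {d c : ℕ} {w : ℕ → Fin d} (bal : Balanced c w) where

  shorter-count≤longer+c : ∀ a m₁ m₂ {k₁ k₂} → k₁ ≤ k₂ →
    count a (factorAt w m₁ k₁) ≤ count a (factorAt w m₂ k₂) + c
  shorter-count≤longer+c a m₁ m₂ {k₁} k₁≤k₂ =
    ≤-trans (∣m-n∣≤o⇒m≤n+o (bal m₁ m₂ k₁ a)) (+-monoˡ-≤ c (count-factorAt-mono w a m₂ k₁≤k₂))

  pair-count≤+c : ∀ a b m₁ k₁ m₂ k₂ →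
    let U = factorAt w m₁ k₁; V = factorAt w m₂ k₂ in
    count a U + count b U ≡ count a V + count b V → count a U ≤ count a V + c
  pair-count≤+c a b m₁ k₁ m₂ k₂ sum≡ with ≤-total k₁ k₂
  ... | inj₁ k₁≤k₂ = shorter-count≤longer+c a m₁ m₂ k₁≤k₂
  ... | inj₂ k₂≤k₁ = +-cancelʳ-≤ Ub Ua (Va + c) (begin
    Ua + Ub        ≡⟨ sum≡ ⟩
    Va + Vb        ≤⟨ +-monoʳ-≤ Va (shorter-count≤longer+c b m₂ m₁ k₂≤k₁) ⟩
    Va + (Ub + c)  ≡⟨ cong (Va +_) (+-comm Ub c) ⟩
    Va + (c + Ub)  ≡⟨ +-assoc Va c Ub ⟨
    Va + c + Ub    ∎)
    where
    open ≤-Reasoning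
    Ua = count a (factorAt w m₁ k₁)
    Ub = count b (factorAt w m₁ k₁)
    Va = count a (factorAt w m₂ k₂)
    Vb = count b (factorAt w m₂ k₂)

  pair-count-close : ∀ a b m₁ k₁ m₂ k₂ →
    let U = factorAt w m₁ k₁; V = factorAt w m₂ k₂ in
    count a U + count b U ≡ count a V + count b V → ∣ count a U - count a V ∣ ≤ c
  pair-count-close a b m₁ k₁ m₂ k₂ sum≡ = m≤n+o∧n≤m+o⇒∣m-n∣≤o _ _ c
    (pair-count≤+c a b m₁ k₁ m₂ k₂ sum≡) (pair-count≤+c a b m₂ k₂ m₁ k₁ (sym sum≡))

  project-count-close : ∀ {i j} → i ≢ j → ∀ m₁ k₁ m₂ k₂ →
    let U = factorAt w m₁ k₁; V = factorAt w m₂ k₂ in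
    length (project i j U) ≡ length (project i j V) →
    ∀ a → ∣ count a (project i j U) - count a (project i j V) ∣ ≤ c
  project-count-close {i} {j} i≢j m₁ k₁ m₂ k₂ length≡ a with inPair? i j a
  ... | yes Pa = subst₂ (λ x y → ∣ x - y ∣ ≤ c)
    (sym (count-filter-accept (inPair? i j) Pa U))
    (sym (count-filter-accept (inPair? i j) Pa V))
    (letter-close Pa)
    where
    U = factorAt w m₁ k₁
    V = factorAt w m₂ k₂
    ij-sum≡ : count i U + count j U ≡ count i V + count j V
    ij-sum≡ = trans (sym (length-project i≢j U)) (trans length≡ (length-project i≢j V))
    letter-close : a ≡ i ⊎ a ≡ j → ∣ count a U - count a V ∣ ≤ c
    letter-close (inj₁ refl) = pair-count-close i j m₁ k₁ m₂ k₂ ij-sum≡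
    letter-close (inj₂ refl) = pair-count-close j i m₁ k₁ m₂ k₂
      (trans (+-comm (count j U) (count i U)) (trans ij-sum≡ (+-comm (count i V) (count j V))))
  ... | no ¬Pa rewrite count-filter-reject (inPair? i j) ¬Pa (factorAt w m₁ k₁)
                     | count-filter-reject (inPair? i j) ¬Pa (factorAt w m₂ k₂) = z≤n

lemma5 : (d : ℕ) → 2 ≤ d → (c : ℕ) → (w : ℕ → Fin d) → Balanced c w →
    (i j : Fin d) → i ≢ j → ProjBalanced c i j w
lemma5 d _ c w bal i j i≢j n u v u-factor v-factor length≡ a
  with factor-filter (inPair? i j) u-factor | factor-filter (inPair? i j) v-factor
... | U , U-factor , refl | V , V-factor , refl
  with factor-factorAt w 0 n U-factor | factor-factorAt w 0 n V-factor
... | m₁ , k₁ , refl | m₂ , k₂ , refl = project-count-close {w = w} bal i≢j m₁ k₁ m₂ k₂ length≡ a
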